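{- Let $n \ge 1$ and let $\mathcal{A}$ be a union-closed family with universe $[n]=\{1,\dots,n\}$ and length $\ell$. Then \[|\mathcal{A}| \le \sum_{i=0}^{\ell}\binom{n}{i},\] with equality if and only if $\mathcal{A} = \bigcup_{i=0}^{\ell}\binom{[n]}{n-i}$.
   Context: A family $\mathcal{A}$ is a finite family of distinct finite sets, at least one of which is nonempty. Its universe is $U(\mathcal{A})=\bigcup_{A\in\mathcal{A}}A$. $\mathcal{A}$ is union-closed if $X_1,X_2\in\mathcal{A}$ implies $X_1\cup X_2\in\mathcal{A}$. A chain in $\mathcal{A}$ is a subfamily any two of whose members are comparable under inclusion; the length $\ell(\mathcal{A})$ of $\mathcal{A}$ is one less than the maximum size of a chain in $\mathcal{A}$. For a set $S$, $\binom{S}{r}$ denotes the family of $r$-element subsets of $S$. -}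

module Defs where

open import Data.Nat using (ℕ; suc; _+_; _≤_; _∸_)
open import Data.Nat.Combinatorics using (_C_)
open import Data.Fin.Subset using (Subset; _∪_; _⊆_; ⊤; ∣_∣)
open import Data.List using (List; length)
open import Data.List.Membership.Propositional using (_∈_)
open import Data.List.Relation.Unary.Unique.Propositional using (Unique)
open import Data.List.Relation.Unary.All using (All)
open import Data.List.Relation.Unary.AllPairs using (AllPairs)
open import Data.Product using (_×_; Σ; ∃)
open import Data.Sum using (_⊎_)
open import Relation.Binary.PropositionalEquality using (_≡_)

-- Subsets of [n] are modelled as subsets of Fin n.
-- A family on ground set [n] is a duplicate-free list of subsets of [n].
record Family (n : ℕ) : Set where
  constructor family
  field
    members  : List (Subset n)
    distinct : Unique members
open Family public

_∈F_ : ∀ {n} → Subset n → Family n → Set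
X ∈F 𝒜 = X ∈ members 𝒜

∣_∣F : ∀ {n} → Family n → ℕ
∣ 𝒜 ∣F = length (members 𝒜)

UniverseIsFull : ∀ {n} → Family n → Set
UniverseIsFull {n} 𝒜 = ∀ (x : Data.Fin.Fin n) → ∃ λ X → X ∈F 𝒜 × x Data.Fin.Subset.∈ X
  where import Data.Fin

UnionClosed : ∀ {n} → Family n → Set
UnionClosed 𝒜 = ∀ X Y → X ∈F 𝒜 → Y ∈F 𝒜 → (X ∪ Y) ∈F 𝒜

Comparable : ∀ {n} → Subset n → Subset n → Set
Comparable X Y = X ⊆ Y ⊎ Y ⊆ X

record Chain {n : ℕ} (𝒜 : Family n) : Set where
  field
    elems      : List (Subset n)
    inFamily   : All (_∈F 𝒜) elems
    chDistinct : Unique elems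
    pairwise   : AllPairs Comparable elems
open Chain public

-- ℓ(𝒜) = ℓ : the maximum size of a chain in 𝒜 is ℓ + 1
HasLength : ∀ {n} → Family n → ℕ → Set
HasLength 𝒜 ℓ = (Σ (Chain 𝒜) λ c → length (elems c) ≡ suc ℓ)
              × (∀ (c : Chain 𝒜) → length (elems c) ≤ suc ℓ)

binomSum : ℕ → ℕ → ℕ
binomSum n 0       = n C 0
binomSum n (suc ℓ) = binomSum n ℓ + n C (suc ℓ)

IsTopLayers : ∀ {n} → Family n → ℕ → Set
IsTopLayers {n} 𝒜 ℓ =
  ∀ (X : Subset n) → (X ∈F 𝒜 → Σ ℕ λ i → i ≤ ℓ × ∣ X ∣ ≡ n ∸ i)
                   × ((Σ ℕ λ i → i ≤ ℓ × ∣ X ∣ ≡ n ∸ i) → X ∈F 𝒜)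

-- Induction on n, splitting 𝒜 along the first element into 𝒜₀ (members avoiding it) and 𝒜₁
-- (members containing it, with it removed). Both halves are union-closed of length at most ℓ, and
-- if 𝒜₁ is inhabited by some t then every chain of 𝒜₀ with top X extends in 𝒜 by X ∪ t, so 𝒜₀ has
-- length at most ℓ - 1 (it is empty if ℓ = 0). Pascal's rule then gives the bound.
--
-- For equality both halves must be extremal. By induction 𝒜₁ consists of the top ℓ + 1 layers
-- and 𝒜₀ of the top ℓ; in the base case ℓ = 1 the singleton 𝒜₀ = {M} must be [n], since
-- otherwise M ⊂ [n] ∖ {x} ⊂ [n], lifted into 𝒜, would be a chain of length 2. For ℓ = 0 the family
-- is a single set, which is [n] by the universe hypothesis.

module Submission where

open import Data.Bool using (Bool; true; false)
open import Data.Bool.Properties using (∨-idem) renaming (_≟_ to _≟ᵇ_)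
open import Data.Empty using (⊥-elim)
open import Data.Fin.Properties using (all?; ¬∀⟶∃¬)
open import Data.Fin.Subset
  using (Subset; _∪_; _⊆_; _⊂_; ⊤; ∁; ⁅_⁆; ∣_∣) renaming (_∈_ to _∈ₛ_; _∉_ to _∉ₛ_)
open import Data.Fin.Subset.Properties
  using ( _∈?_; ⊆-antisym; ⊆⊤; ∈⊤; p⊂q⇒p⊆q; ⊂-trans; ⊂-irref; s⊂s; out⊂in
        ; p⊆p∪q; ∣p∣≤n; ∣⊤∣≡n; ∣p∣≡n⇒p≡⊤; x∈⁅x⁆; x∈⁅y⁆⇒x≡y; ∣⁅x⁆∣≡1; ∣∁p∣≡n∸∣p∣
        ; x∈p⇒x∉∁p; x∉p⇒x∈∁p)
open import Data.List using (List; []; _∷_; length)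
open import Data.List.Membership.Propositional using (_∈_)
open import Data.List.Membership.Propositional.Properties using (∈-length)
open import Data.List.Relation.Unary.All as All using (All; []; _∷_)
open import Data.List.Relation.Unary.All.Properties using (¬Any⇒All¬; All¬⇒¬Any)
open import Data.List.Relation.Unary.AllPairs using (AllPairs; []; _∷_)
open import Data.List.Relation.Unary.Any using (here; there)
open import Data.List.Relation.Unary.Unique.Propositional using (Unique)
open import Data.Nat using (ℕ; zero; suc; _+_; _∸_; _≤_; _<_; _≥_; z≤n; s≤s; s≤s⁻¹)
open import Data.Nat.Combinatorics using (_C_; nCk+nC[k+1]≡[n+1]C[k+1])
open import Data.Nat.Properties
open import Algebra.Properties.CommutativeSemigroup +-commutativeSemigroup using (interchange)
open import Data.Product using (_×_; Σ; ∃; _,_; proj₁; proj₂)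
open import Data.Sum using (_⊎_; inj₁; inj₂)
open import Data.Vec using ([]; _∷_)
open import Function using (_∘_)
open import Function.Bundles using (_⇔_; mk⇔; Equivalence)
open import Function.Construct.Composition using (_⇔-∘_)
open import Function.Construct.Symmetry using (⇔-sym)
open import Relation.Nullary using (¬_; yes; no)
open import Relation.Binary.PropositionalEquality
  using (_≡_; refl; sym; trans; cong; cong₂; subst; module ≡-Reasoning)

open import Defs

open Equivalence using (to; from)

private
  variable
    A : Set
    n k ℓ : ℕ
    b : Bool
    X Y M t : Subset n
    xs : List A
    x : A

empty-or-inhabited : (xs : List A) → length xs ≡ 0 ⊎ ∃ (_∈ xs)
empty-or-inhabited []      = inj₁ refl
empty-or-inhabited (x ∷ _) = inj₂ (x , here refl)

length≡suc⇒inhabited : (xs : List A) → length xs ≡ suc k → ∃ (_∈ xs)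
length≡suc⇒inhabited (x ∷ _) _ = x , here refl

length≡1⇒∈-unique : ∀ {y} → length xs ≡ 1 → x ∈ xs → y ∈ xs → x ≡ y
length≡1⇒∈-unique {xs = _ ∷ []} _ (here refl) (here refl) = refl

unique-constant⇒length≤1 : Unique xs → (∀ {y} → y ∈ xs → y ≡ x) → length xs ≤ 1
unique-constant⇒length≤1 {xs = []}    _ _ = z≤n
unique-constant⇒length≤1 {xs = _ ∷ []} _ _ = ≤-refl
unique-constant⇒length≤1 {xs = _ ∷ _ ∷ _} ((y≢z ∷ _) ∷ _) ≡x =
  ⊥-elim (y≢z (trans (≡x (here refl)) (sym (≡x (there (here refl))))))

unique-singleton⇒length≡1 : Unique xs → (∀ y → y ∈ xs ⇔ y ≡ x) → length xs ≡ 1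
unique-singleton⇒length≡1 u ∈⇔≡x =
  ≤-antisym (unique-constant⇒length≤1 u (to (∈⇔≡x _))) (∈-length (from (∈⇔≡x _) refl))

s≤s⇔ : suc k ≤ suc n ⇔ k ≤ n
s≤s⇔ = mk⇔ s≤s⁻¹ s≤s

≤-+suc⇔ : suc k ≤ n + suc ℓ ⇔ k ≤ n + ℓ
≤-+suc⇔ {k = k} {n = n} {ℓ = ℓ} = subst (λ m → suc k ≤ m ⇔ k ≤ n + ℓ) (sym (+-suc n ℓ)) s≤s⇔

+-cancel-≤-≡ : ∀ {a b c d} → a ≤ c → b ≤ d → a + b ≡ c + d → a ≡ c × b ≡ d
+-cancel-≤-≡ {a} {b} {c} {d} a≤c b≤d a+b≡c+d =
  a≡c , +-cancelˡ-≡ c b d (trans (cong (_+ b) (sym a≡c)) a+b≡c+d)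
  where
  a≡c : a ≡ c
  a≡c = ≤-antisym a≤c (+-cancelʳ-≤ d c a (≤-trans (≤-reflexive (sym a+b≡c+d)) (+-monoʳ-≤ a b≤d)))

layer⇔ : ∀ {m} → m ≤ n → (Σ ℕ λ i → i ≤ ℓ × m ≡ n ∸ i) ⇔ n ≤ m + ℓ
layer⇔ {n = n} {ℓ = ℓ} {m = m} m≤n = mk⇔ into onto
  where
  into : (Σ ℕ λ i → i ≤ ℓ × m ≡ n ∸ i) → n ≤ m + ℓ
  into (i , i≤ℓ , m≡n∸i) =
    ≤-trans (m≤n+m∸n n i) (subst (i + (n ∸ i) ≤_) (+-comm ℓ m) (+-mono-≤ i≤ℓ (≤-reflexive (sym m≡n∸i))))
  onto : n ≤ m + ℓ → Σ ℕ λ i → i ≤ ℓ × m ≡ n ∸ i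
  onto n≤m+ℓ = n ∸ m , m≤n+o⇒m∸n≤o n m n≤m+ℓ , sym (m∸[m∸n]≡n m≤n)

binomSum-zeroDim : ∀ ℓ → binomSum 0 ℓ ≡ 1
binomSum-zeroDim zero    = refl
binomSum-zeroDim (suc ℓ) = cong (_+ 0) (binomSum-zeroDim ℓ)

binomSum-positive : ∀ n ℓ → 1 ≤ binomSum n ℓ
binomSum-positive n zero    = ≤-refl
binomSum-positive n (suc ℓ) = ≤-trans (binomSum-positive n ℓ) (m≤m+n _ _)

binomSum-pascal : ∀ n ℓ → binomSum (suc n) (suc ℓ) ≡ binomSum n ℓ + binomSum n (suc ℓ)
binomSum-pascal n zero    = cong (1 +_) (sym (nCk+nC[k+1]≡[n+1]C[k+1] n 0))
binomSum-pascal n (suc ℓ) = trans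
  (cong₂ _+_ (binomSum-pascal n ℓ) (sym (nCk+nC[k+1]≡[n+1]C[k+1] n (suc ℓ))))
  (interchange (binomSum n ℓ) (binomSum n (suc ℓ)) (n C suc ℓ) (n C suc (suc ℓ)))

binomSum-mono : ∀ n ℓ → binomSum n ℓ ≤ binomSum (suc n) ℓ
binomSum-mono n zero    = ≤-refl
binomSum-mono n (suc ℓ) =
  subst (binomSum n (suc ℓ) ≤_) (sym (binomSum-pascal n ℓ)) (m≤n+m (binomSum n (suc ℓ)) (binomSum n ℓ))

subset₀≡⊤ : (X : Subset 0) → X ≡ ⊤
subset₀≡⊤ [] = refl

⊤-or-∃∉ : (M : Subset n) → M ≡ ⊤ ⊎ ∃ (_∉ₛ M)
⊤-or-∃∉ {n = n} M with all? (_∈? M)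
... | yes all∈ = inj₁ (⊆-antisym ⊆⊤ (λ {x} _ → all∈ x))
... | no ¬all∈ = inj₂ (¬∀⟶∃¬ n (_∈ₛ M) (_∈? M) ¬all∈)

full⇔≡⊤ : {X : Subset n} → n ≤ ∣ X ∣ + 0 ⇔ X ≡ ⊤
full⇔≡⊤ {n = n} {X = X} = mk⇔
  (λ n≤∣X∣ → ∣p∣≡n⇒p≡⊤ (≤-antisym (∣p∣≤n X) (subst (n ≤_) (+-identityʳ _) n≤∣X∣)))
  (λ { refl → subst (n ≤_) (sym (trans (+-identityʳ _) (∣⊤∣≡n n))) ≤-refl })

-- Splitting a family along the first coordinate

sliceMembers : Bool → List (Subset (suc n)) → List (Subset n)
sliceMembers b [] = []
sliceMembers b ((c ∷ s) ∷ xs) with b ≟ᵇ c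
... | yes _ = s ∷ sliceMembers b xs
... | no  _ = sliceMembers b xs

∈-sliceMembers⁻ : ∀ b (xs : List (Subset (suc n))) → X ∈ sliceMembers b xs → (b ∷ X) ∈ xs
∈-sliceMembers⁻ b ((c ∷ s) ∷ xs) X∈ with b ≟ᵇ c | X∈
... | yes refl | here refl = here refl
... | yes refl | there X∈′ = there (∈-sliceMembers⁻ b xs X∈′)
... | no _     | X∈′       = there (∈-sliceMembers⁻ b xs X∈′)

∈-sliceMembers⁺ : ∀ b (xs : List (Subset (suc n))) → (b ∷ X) ∈ xs → X ∈ sliceMembers b xs
∈-sliceMembers⁺ b ((c ∷ s) ∷ xs) bX∈ with b ≟ᵇ c | bX∈
... | yes refl | here refl  = here refl
... | yes refl | there bX∈′ = there (∈-sliceMembers⁺ b xs bX∈′)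
... | no b≢c   | here refl  = ⊥-elim (b≢c refl)
... | no _     | there bX∈′ = ∈-sliceMembers⁺ b xs bX∈′

sliceMembers-unique : ∀ b (xs : List (Subset (suc n))) → Unique xs → Unique (sliceMembers b xs)
sliceMembers-unique b [] [] = []
sliceMembers-unique b ((c ∷ s) ∷ xs) (cs∉xs ∷ u) with b ≟ᵇ c
... | yes refl = ¬Any⇒All¬ _ (All¬⇒¬Any cs∉xs ∘ ∈-sliceMembers⁻ b xs) ∷ sliceMembers-unique b xs u
... | no _     = sliceMembers-unique b xs u

length-sliceMembers : (xs : List (Subset (suc n))) →
                      length xs ≡ length (sliceMembers false xs) + length (sliceMembers true xs)
length-sliceMembers [] = refl
length-sliceMembers ((false ∷ _) ∷ xs) = cong suc (length-sliceMembers xs)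
length-sliceMembers ((true ∷ _) ∷ xs)  = trans (cong suc (length-sliceMembers xs)) (sym (+-suc _ _))

slice : Bool → Family (suc n) → Family n
slice b 𝒜 = family (sliceMembers b (members 𝒜)) (sliceMembers-unique b (members 𝒜) (distinct 𝒜))

∈-slice : (𝒜 : Family (suc n)) → X ∈F slice b 𝒜 ⇔ (b ∷ X) ∈F 𝒜
∈-slice {b = b} 𝒜 = mk⇔ (∈-sliceMembers⁻ b (members 𝒜)) (∈-sliceMembers⁺ b (members 𝒜))

size-slices : (𝒜 : Family (suc n)) → ∣ 𝒜 ∣F ≡ ∣ slice false 𝒜 ∣F + ∣ slice true 𝒜 ∣F
size-slices 𝒜 = length-sliceMembers (members 𝒜)

module _ (𝒜 : Family (suc n)) where

  size-slice-false : ∣ slice true 𝒜 ∣F ≡ 0 → ∣ 𝒜 ∣F ≡ ∣ slice false 𝒜 ∣F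
  size-slice-false 𝒜₁-empty =
    trans (size-slices 𝒜) (trans (cong (∣ slice false 𝒜 ∣F +_) 𝒜₁-empty) (+-identityʳ _))

  slice-unionClosed : UnionClosed 𝒜 → UnionClosed (slice b 𝒜)
  slice-unionClosed {b = b} uc X Y X∈ Y∈ =
    from (∈-slice 𝒜) (subst (_∈F 𝒜) (cong (_∷ (X ∪ Y)) (∨-idem b))
                             (uc _ _ (to (∈-slice 𝒜) X∈) (to (∈-slice 𝒜) Y∈)))

-- Strict chains

infixr 5 _⊃⟨_⟩_

data StrictChain (P : Subset n → Set) : ℕ → Subset n → Set where
  [_]    : P X → StrictChain P 1 X
  _⊃⟨_⟩_ : P X → Y ⊂ X → StrictChain P k Y → StrictChain P (suc k) X

LengthAtMost : Family n → ℕ → Set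
LengthAtMost 𝒜 ℓ = ∀ X → ¬ StrictChain (_∈F 𝒜) (2 + ℓ) X

module _ {P : Subset n → Set} where

  chain-top : StrictChain P k X → P X
  chain-top [ p ]       = p
  chain-top (p ⊃⟨ _ ⟩ _) = p

  map-chain : ∀ {m} {Q : Subset m → Set} (f : Subset n → Subset m) →
              (∀ {X} → P X → Q (f X)) → (∀ {X Y} → Y ⊂ X → f Y ⊂ f X) →
              StrictChain P k X → StrictChain Q k (f X)
  map-chain f P⇒Q f-mono [ p ]          = [ P⇒Q p ]
  map-chain f P⇒Q f-mono (p ⊃⟨ Y⊂X ⟩ c) = P⇒Q p ⊃⟨ f-mono Y⊂X ⟩ map-chain f P⇒Q f-mono c

  elements : StrictChain P k X → List (Subset n)
  elements {X = X} [ _ ]       = X ∷ []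
  elements {X = X} (_ ⊃⟨ _ ⟩ c) = X ∷ elements c

  elements-length : (c : StrictChain P k X) → length (elements c) ≡ k
  elements-length [ _ ]        = refl
  elements-length (_ ⊃⟨ _ ⟩ c) = cong suc (elements-length c)

  elements-satisfy : (c : StrictChain P k X) → All P (elements c)
  elements-satisfy [ p ]        = p ∷ []
  elements-satisfy (p ⊃⟨ _ ⟩ c) = p ∷ elements-satisfy c

  elements-⊂ : (c : StrictChain P k Y) → Y ⊂ X → All (_⊂ X) (elements c)
  elements-⊂ [ _ ]          Y⊂X = Y⊂X ∷ []
  elements-⊂ (_ ⊃⟨ Z⊂Y ⟩ c) Y⊂X = Y⊂X ∷ elements-⊂ c (⊂-trans Z⊂Y Y⊂X)

  elements-unique : (c : StrictChain P k X) → Unique (elements c)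
  elements-unique [ _ ]          = [] ∷ []
  elements-unique (_ ⊃⟨ Y⊂X ⟩ c) =
    All.map (λ Z⊂X X≡Z → ⊂-irref (sym X≡Z) Z⊂X) (elements-⊂ c Y⊂X) ∷ elements-unique c

  elements-comparable : (c : StrictChain P k X) → AllPairs Comparable (elements c)
  elements-comparable [ _ ]          = [] ∷ []
  elements-comparable (_ ⊃⟨ Y⊂X ⟩ c) =
    All.map (inj₂ ∘ p⊂q⇒p⊆q) (elements-⊂ c Y⊂X) ∷ elements-comparable c

hasLength⇒lengthAtMost : {𝒜 : Family n} → HasLength 𝒜 ℓ → LengthAtMost 𝒜 ℓ
hasLength⇒lengthAtMost {ℓ = ℓ} {𝒜 = 𝒜} (_ , ≤suc) X c =
  1+n≰n (subst (_≤ suc ℓ) (elements-length c) (≤suc chain))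
  where
  chain : Chain 𝒜
  chain = record { elems      = elements c
                 ; inFamily   = elements-satisfy c
                 ; chDistinct = elements-unique c
                 ; pairwise   = elements-comparable c }

module _ (𝒜 : Family (suc n)) where

  slice-lengthAtMost : LengthAtMost 𝒜 ℓ → LengthAtMost (slice b 𝒜) ℓ
  slice-lengthAtMost {b = b} short X c = short (b ∷ X) (map-chain (b ∷_) (to (∈-slice 𝒜)) s⊂s c)

  extend-chain : UnionClosed 𝒜 → t ∈F slice true 𝒜 →
                 StrictChain (_∈F slice false 𝒜) k X → StrictChain (_∈F 𝒜) (suc k) (true ∷ (X ∪ t))
  extend-chain {t = t} uc t∈ c =
    uc _ _ (to (∈-slice 𝒜) (chain-top c)) (to (∈-slice 𝒜) t∈)
    ⊃⟨ out⊂in (p⊆p∪q t) ⟩ map-chain (false ∷_) (to (∈-slice 𝒜)) s⊂s c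

  slice-false-lengthAtMost : UnionClosed 𝒜 → t ∈F slice true 𝒜 →
                             LengthAtMost 𝒜 (suc ℓ) → LengthAtMost (slice false 𝒜) ℓ
  slice-false-lengthAtMost uc t∈ short X c = short _ (extend-chain uc t∈ c)

  slice-false-empty : UnionClosed 𝒜 → t ∈F slice true 𝒜 → LengthAtMost 𝒜 0 → ∣ slice false 𝒜 ∣F ≡ 0
  slice-false-empty uc t∈ short with empty-or-inhabited (members (slice false 𝒜))
  ... | inj₁ empty    = empty
  ... | inj₂ (X , X∈) = ⊥-elim (short _ (extend-chain uc t∈ [ X∈ ]))

size-bound : ∀ n ℓ (𝒜 : Family n) → UnionClosed 𝒜 → LengthAtMost 𝒜 ℓ → ∣ 𝒜 ∣F ≤ binomSum n ℓ
size-bound zero ℓ 𝒜 _ _ = subst (∣ 𝒜 ∣F ≤_) (sym (binomSum-zeroDim ℓ))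
  (unique-constant⇒length≤1 (distinct 𝒜) (λ {X} _ → subset₀≡⊤ X))
size-bound (suc n) ℓ 𝒜 uc short with empty-or-inhabited (members (slice true 𝒜))
... | inj₁ 𝒜₁-empty = begin
  ∣ 𝒜 ∣F             ≡⟨ size-slice-false 𝒜 𝒜₁-empty ⟩
  ∣ slice false 𝒜 ∣F ≤⟨ bound₀ ⟩
  binomSum n ℓ       ≤⟨ binomSum-mono n ℓ ⟩
  binomSum (suc n) ℓ ∎
  where
  open ≤-Reasoning
  bound₀ : ∣ slice false 𝒜 ∣F ≤ binomSum n ℓ
  bound₀ = size-bound n ℓ (slice false 𝒜) (slice-unionClosed 𝒜 uc) (slice-lengthAtMost 𝒜 short)
size-bound (suc n) zero 𝒜 uc short | inj₂ (t , t∈) = begin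
  ∣ 𝒜 ∣F                                 ≡⟨ size-slices 𝒜 ⟩
  ∣ slice false 𝒜 ∣F + ∣ slice true 𝒜 ∣F ≡⟨ cong (_+ ∣ slice true 𝒜 ∣F) (slice-false-empty 𝒜 uc t∈ short) ⟩
  ∣ slice true 𝒜 ∣F                      ≤⟨ bound₁ ⟩
  1                                      ∎
  where
  open ≤-Reasoning
  bound₁ : ∣ slice true 𝒜 ∣F ≤ binomSum n 0
  bound₁ = size-bound n 0 (slice true 𝒜) (slice-unionClosed 𝒜 uc) (slice-lengthAtMost 𝒜 short)
size-bound (suc n) (suc ℓ) 𝒜 uc short | inj₂ (t , t∈) = begin
  ∣ 𝒜 ∣F                                 ≡⟨ size-slices 𝒜 ⟩
  ∣ slice false 𝒜 ∣F + ∣ slice true 𝒜 ∣F ≤⟨ +-mono-≤ bound₀ bound₁ ⟩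
  binomSum n ℓ + binomSum n (suc ℓ)      ≡⟨ sym (binomSum-pascal n ℓ) ⟩
  binomSum (suc n) (suc ℓ)               ∎
  where
  open ≤-Reasoning
  bound₀ : ∣ slice false 𝒜 ∣F ≤ binomSum n ℓ
  bound₀ =
    size-bound n ℓ (slice false 𝒜) (slice-unionClosed 𝒜 uc) (slice-false-lengthAtMost 𝒜 uc t∈ short)
  bound₁ : ∣ slice true 𝒜 ∣F ≤ binomSum n (suc ℓ)
  bound₁ = size-bound n (suc ℓ) (slice true 𝒜) (slice-unionClosed 𝒜 uc) (slice-lengthAtMost 𝒜 short)

-- Top layers and the equality case

-- IsTopLayers with the truncated subtraction n ∸ i eliminated.
TopLayers : Family n → ℕ → Set
TopLayers {n} 𝒜 ℓ = ∀ X → X ∈F 𝒜 ⇔ n ≤ ∣ X ∣ + ℓ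

isTopLayers⇔topLayers : (𝒜 : Family n) → IsTopLayers 𝒜 ℓ ⇔ TopLayers 𝒜 ℓ
isTopLayers⇔topLayers 𝒜 = mk⇔
  (λ it X → mk⇔ (to (layer⇔ (∣p∣≤n X)) ∘ proj₁ (it X)) (proj₂ (it X) ∘ from (layer⇔ (∣p∣≤n X))))
  (λ T X → from (layer⇔ (∣p∣≤n X)) ∘ to (T X) , from (T X) ∘ to (layer⇔ (∣p∣≤n X)))

topLayers₀⇔ : (𝒜 : Family n) → TopLayers 𝒜 0 ⇔ (∀ X → X ∈F 𝒜 ⇔ X ≡ ⊤)
topLayers₀⇔ 𝒜 = mk⇔ (λ T X → full⇔≡⊤ ⇔-∘ T X) (λ ∈⇔≡⊤ X → ⇔-sym full⇔≡⊤ ⇔-∘ ∈⇔≡⊤ X)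

constant-⊤⇒topLayers₀ : (𝒜 : Family n) → (∀ {X} → X ∈F 𝒜 → X ≡ ⊤) → M ∈F 𝒜 → TopLayers 𝒜 0
constant-⊤⇒topLayers₀ 𝒜 ≡⊤ M∈ =
  from (topLayers₀⇔ 𝒜) (λ X → mk⇔ ≡⊤ (λ { refl → subst (_∈F 𝒜) (≡⊤ M∈) M∈ }))

topLayers-slices : (𝒜 : Family (suc n)) →
                   TopLayers 𝒜 (suc ℓ) ⇔ (TopLayers (slice false 𝒜) ℓ × TopLayers (slice true 𝒜) (suc ℓ))
topLayers-slices 𝒜 = mk⇔
  (λ T → (λ s → ≤-+suc⇔ ⇔-∘ (T (false ∷ s) ⇔-∘ ∈-slice 𝒜))
       , (λ s → s≤s⇔ ⇔-∘ (T (true ∷ s) ⇔-∘ ∈-slice 𝒜)))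
  (λ { (T₀ , T₁) (false ∷ s) → ⇔-sym ≤-+suc⇔ ⇔-∘ (T₀ s ⇔-∘ ⇔-sym (∈-slice 𝒜))
     ; (T₀ , T₁) (true ∷ s)  → ⇔-sym s≤s⇔ ⇔-∘ (T₁ s ⇔-∘ ⇔-sym (∈-slice 𝒜)) })

topLayers⇒size : ∀ n ℓ (𝒜 : Family n) → TopLayers 𝒜 ℓ → ∣ 𝒜 ∣F ≡ binomSum n ℓ
topLayers⇒size n zero 𝒜 T = unique-singleton⇒length≡1 (distinct 𝒜) (to (topLayers₀⇔ 𝒜) T)
topLayers⇒size zero (suc ℓ) 𝒜 T =
  trans (unique-singleton⇒length≡1 (distinct 𝒜) (λ { [] → mk⇔ (λ _ → refl) (λ _ → from (T []) z≤n) }))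
        (sym (binomSum-zeroDim (suc ℓ)))
topLayers⇒size (suc n) (suc ℓ) 𝒜 T = begin
  ∣ 𝒜 ∣F                                 ≡⟨ size-slices 𝒜 ⟩
  ∣ slice false 𝒜 ∣F + ∣ slice true 𝒜 ∣F ≡⟨ cong₂ _+_ (topLayers⇒size n ℓ (slice false 𝒜) T₀)
                                                (topLayers⇒size n (suc ℓ) (slice true 𝒜) T₁) ⟩
  binomSum n ℓ + binomSum n (suc ℓ)      ≡⟨ sym (binomSum-pascal n ℓ) ⟩
  binomSum (suc n) (suc ℓ)               ∎
  where
  open ≡-Reasoning
  T₀ : TopLayers (slice false 𝒜) ℓ
  T₀ = proj₁ (to (topLayers-slices 𝒜) T)
  T₁ : TopLayers (slice true 𝒜) (suc ℓ)
  T₁ = proj₂ (to (topLayers-slices 𝒜) T)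

universeFull⇒topLayers₀ : (𝒜 : Family n) → UniverseIsFull 𝒜 → ∣ 𝒜 ∣F ≡ 1 → TopLayers 𝒜 0
universeFull⇒topLayers₀ 𝒜 full size≡1 =
  constant-⊤⇒topLayers₀ 𝒜 member≡⊤ (proj₂ (length≡suc⇒inhabited (members 𝒜) size≡1))
  where
  member≡⊤ : ∀ {M} → M ∈F 𝒜 → M ≡ ⊤
  member≡⊤ M∈ = ⊆-antisym ⊆⊤ λ {x} _ →
    let (X , X∈ , x∈X) = full x in subst (x ∈ₛ_) (length≡1⇒∈-unique size≡1 X∈ M∈) x∈X

slice-false-⊤ : (𝒜 : Family (suc n)) → LengthAtMost 𝒜 1 → TopLayers (slice true 𝒜) 1 →
                M ∈F slice false 𝒜 → M ≡ ⊤
slice-false-⊤ {n = n} {M = M} 𝒜 short T₁ M∈ with ⊤-or-∃∉ M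
... | inj₁ M≡⊤       = M≡⊤
... | inj₂ (x , x∉M) = ⊥-elim (short (true ∷ ⊤) three-chain)
  where
  open ≤-Reasoning
  ⊤-large : n ≤ ∣ ⊤ {n} ∣ + 1
  ⊤-large = ≤-trans (m≤m+n n 1) (≤-reflexive (cong (_+ 1) (sym (∣⊤∣≡n n))))
  ∁⁅x⁆-large : n ≤ ∣ ∁ ⁅ x ⁆ ∣ + 1
  ∁⁅x⁆-large = begin
    n                     ≤⟨ m≤n+m∸n n 1 ⟩
    1 + (n ∸ 1)           ≡⟨ +-comm 1 _ ⟩
    n ∸ 1 + 1             ≡⟨ cong (λ m → n ∸ m + 1) (sym (∣⁅x⁆∣≡1 x)) ⟩
    n ∸ ∣ ⁅ x ⁆ ∣ + 1     ≡⟨ cong (_+ 1) (sym (∣∁p∣≡n∸∣p∣ ⁅ x ⁆)) ⟩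
    ∣ ∁ ⁅ x ⁆ ∣ + 1       ∎
  ∁⁅x⁆⊂⊤ : ∁ ⁅ x ⁆ ⊂ ⊤
  ∁⁅x⁆⊂⊤ = ⊆⊤ , x , ∈⊤ , x∈p⇒x∉∁p (x∈⁅x⁆ x)
  M⊆∁⁅x⁆ : M ⊆ ∁ ⁅ x ⁆
  M⊆∁⁅x⁆ {y} y∈M = x∉p⇒x∈∁p λ y∈⁅x⁆ → x∉M (subst (_∈ₛ M) (x∈⁅y⁆⇒x≡y x y∈⁅x⁆) y∈M)
  three-chain : StrictChain (_∈F 𝒜) 3 (true ∷ ⊤)
  three-chain = to (∈-slice 𝒜) (from (T₁ ⊤) ⊤-large)
    ⊃⟨ s⊂s ∁⁅x⁆⊂⊤ ⟩ to (∈-slice 𝒜) (from (T₁ (∁ ⁅ x ⁆)) ∁⁅x⁆-large)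
    ⊃⟨ out⊂in M⊆∁⁅x⁆ ⟩ [ to (∈-slice 𝒜) M∈ ]

ExtremalAreTopLayers : ℕ → Set
ExtremalAreTopLayers n = ∀ ℓ (𝒜 : Family n) → UnionClosed 𝒜 → LengthAtMost 𝒜 (suc ℓ) →
                         ∣ 𝒜 ∣F ≡ binomSum n (suc ℓ) → TopLayers 𝒜 (suc ℓ)

extremal-zeroDim : ExtremalAreTopLayers 0
extremal-zeroDim ℓ 𝒜 _ _ size
  with length≡suc⇒inhabited (members 𝒜) (trans size (binomSum-zeroDim (suc ℓ)))
... | [] , []∈ = λ { [] → mk⇔ (λ _ → z≤n) (λ _ → []∈) }

slice-false-topLayers : ExtremalAreTopLayers n → ∀ ℓ (𝒜 : Family (suc n)) → UnionClosed 𝒜 →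
                        t ∈F slice true 𝒜 → LengthAtMost 𝒜 (suc ℓ) → TopLayers (slice true 𝒜) (suc ℓ) →
                        ∣ slice false 𝒜 ∣F ≡ binomSum n ℓ → TopLayers (slice false 𝒜) ℓ
slice-false-topLayers ih zero 𝒜 _ _ short T₁ size₀ =
  constant-⊤⇒topLayers₀ (slice false 𝒜) (slice-false-⊤ 𝒜 short T₁)
    (proj₂ (length≡suc⇒inhabited (members (slice false 𝒜)) size₀))
slice-false-topLayers ih (suc ℓ) 𝒜 uc t∈ short _ size₀ =
  ih ℓ (slice false 𝒜) (slice-unionClosed 𝒜 uc) (slice-false-lengthAtMost 𝒜 uc t∈ short) size₀

extremal-step : ExtremalAreTopLayers n → ExtremalAreTopLayers (suc n)
extremal-step {n = n} ih ℓ 𝒜 uc short size with empty-or-inhabited (members (slice true 𝒜))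
... | inj₁ 𝒜₁-empty = ⊥-elim (<⇒≱ too-large
        (size-bound n (suc ℓ) (slice false 𝒜) (slice-unionClosed 𝒜 uc) (slice-lengthAtMost 𝒜 short)))
  where
  open ≤-Reasoning
  too-large : binomSum n (suc ℓ) < ∣ slice false 𝒜 ∣F
  too-large = begin-strict
    binomSum n (suc ℓ)                <⟨ m<n+m _ (binomSum-positive n ℓ) ⟩
    binomSum n ℓ + binomSum n (suc ℓ) ≡⟨ sym (binomSum-pascal n ℓ) ⟩
    binomSum (suc n) (suc ℓ)          ≡⟨ sym size ⟩
    ∣ 𝒜 ∣F                            ≡⟨ size-slice-false 𝒜 𝒜₁-empty ⟩
    ∣ slice false 𝒜 ∣F                ∎
... | inj₂ (t , t∈) = from (topLayers-slices 𝒜) (T₀ , T₁)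
  where
  sizes : ∣ slice false 𝒜 ∣F ≡ binomSum n ℓ × ∣ slice true 𝒜 ∣F ≡ binomSum n (suc ℓ)
  sizes = +-cancel-≤-≡
    (size-bound n ℓ (slice false 𝒜) (slice-unionClosed 𝒜 uc) (slice-false-lengthAtMost 𝒜 uc t∈ short))
    (size-bound n (suc ℓ) (slice true 𝒜) (slice-unionClosed 𝒜 uc) (slice-lengthAtMost 𝒜 short))
    (trans (sym (size-slices 𝒜)) (trans size (binomSum-pascal n ℓ)))
  T₁ : TopLayers (slice true 𝒜) (suc ℓ)
  T₁ = ih ℓ (slice true 𝒜) (slice-unionClosed 𝒜 uc) (slice-lengthAtMost 𝒜 short) (proj₂ sizes)
  T₀ : TopLayers (slice false 𝒜) ℓ
  T₀ = slice-false-topLayers ih ℓ 𝒜 uc t∈ short T₁ (proj₁ sizes)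

extremal : ∀ n → ExtremalAreTopLayers n
extremal zero    = extremal-zeroDim
extremal (suc n) = extremal-step (extremal n)

size≡⇔topLayers : ∀ n ℓ (𝒜 : Family n) → UniverseIsFull 𝒜 → UnionClosed 𝒜 → LengthAtMost 𝒜 ℓ →
                  (∣ 𝒜 ∣F ≡ binomSum n ℓ) ⇔ TopLayers 𝒜 ℓ
size≡⇔topLayers n zero    𝒜 full _  _     = mk⇔ (universeFull⇒topLayers₀ 𝒜 full) (topLayers⇒size n 0 𝒜)
size≡⇔topLayers n (suc ℓ) 𝒜 _    uc short = mk⇔ (extremal n ℓ 𝒜 uc short) (topLayers⇒size n (suc ℓ) 𝒜)

theorem1 : ∀ (n : ℕ) → n ≥ 1 → (𝒜 : Family n) → (ℓ : ℕ) →
           UniverseIsFull 𝒜 → UnionClosed 𝒜 → HasLength 𝒜 ℓ →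
           (∣ 𝒜 ∣F ≤ binomSum n ℓ) × ((∣ 𝒜 ∣F ≡ binomSum n ℓ) ⇔ IsTopLayers 𝒜 ℓ)
theorem1 n _ 𝒜 ℓ full uc hasLength =
  size-bound n ℓ 𝒜 uc short ,
  ⇔-sym (isTopLayers⇔topLayers 𝒜) ⇔-∘ size≡⇔topLayers n ℓ 𝒜 full uc short
  where
  short : LengthAtMost 𝒜 ℓ
  short = hasLength⇒lengthAtMost hasLength
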